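{- Let $G$ be a finite simple graph such that $\mathrm{Z}_t(G)$ exists, and let $v$ be a vertex of $G$ such that the graph $G-v$ (obtained by deleting $v$ and its incident edges) has no isolated vertices. Then $$\mathrm{Z}_t(G)-\mathrm{Z}_t(G-v)\le 2.$$
   Context: Zero forcing: given a set $B\subseteq V(G)$ of initially blue vertices (all others white), the color change rule allows a blue vertex $b$ to turn a white vertex $w$ blue if $w$ is the unique white neighbor of $b$. $B$ is a zero forcing set if repeated application of this rule eventually turns all of $V(G)$ blue. A set $B\subseteq V(G)$ with $|B|=m\ge 1$ is a fault tolerant zero forcing set if every subset $F\subseteq B$ with $|F|=m-1$ is a zero forcing set of $G$. $\mathrm{Z}_t(G)$ is the minimum cardinality of a fault tolerant zero forcing set of $G$; it exists if some fault tolerant zero forcing set exists. -}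

module Defs where

open import Data.Nat using (ℕ; suc; _≤_; _∸_)
open import Data.Bool using (Bool; true; false)
open import Data.Fin using (Fin; punchIn)
open import Data.Fin.Subset using (Subset; _∈_; _⊆_; ∣_∣)
open import Data.Product using (Σ; ∃; _×_)
open import Relation.Binary.PropositionalEquality using (_≡_; _≢_; sym)
open import Data.Fin.Properties using (punchIn-injective)

record SimpleGraph (n : ℕ) : Set where
  field
    adj     : Fin n → Fin n → Bool
    adj-sym : ∀ i j → adj i j ≡ adj j i
    irrefl  : ∀ i → adj i i ≡ false
open SimpleGraph public

Adj : ∀ {n} → SimpleGraph n → Fin n → Fin n → Set
Adj G i j = adj G i j ≡ true

-- G - v : delete vertex v; the remaining vertices are renumbered
-- via punchIn v : Fin n → Fin (suc n).
deleteVertex : ∀ {n} → SimpleGraph (suc n) → Fin (suc n) → SimpleGraph n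
deleteVertex G v = record
  { adj     = λ i j → adj G (punchIn v i) (punchIn v j)
  ; adj-sym = λ i j → adj-sym G (punchIn v i) (punchIn v j)
  ; irrefl  = λ i → irrefl G (punchIn v i)
  }

NoIsolated : ∀ {n} → SimpleGraph n → Set
NoIsolated {n} G = ∀ (i : Fin n) → ∃ λ j → Adj G i j

-- Vertices that end up blue starting from the blue set B, by repeatedly
-- applying the colour change rule: a blue vertex b turns w blue when w is
-- b's only (possibly) white neighbour, i.e. all other neighbours are blue.
data Blue {n} (G : SimpleGraph n) (B : Subset n) : Fin n → Set where
  initial : ∀ {x} → x ∈ B → Blue G B x
  force   : ∀ {b w} → Blue G B b → Adj G b w →
            (∀ u → Adj G b u → u ≢ w → Blue G B u) → Blue G B w

IsZeroForcingSet : ∀ {n} → SimpleGraph n → Subset n → Set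
IsZeroForcingSet {n} G B = ∀ (x : Fin n) → Blue G B x

IsFaultTolerantZFS : ∀ {n} → SimpleGraph n → Subset n → Set
IsFaultTolerantZFS {n} G B =
  (1 ≤ ∣ B ∣) ×
  (∀ (F : Subset n) → F ⊆ B → ∣ F ∣ ≡ ∣ B ∣ ∸ 1 → IsZeroForcingSet G F)

ZtExists : ∀ {n} → SimpleGraph n → Set
ZtExists {n} G = ∃ λ (B : Subset n) → IsFaultTolerantZFS G B

IsZt : ∀ {n} → SimpleGraph n → ℕ → Set
IsZt {n} G k =
  (∃ λ (B : Subset n) → IsFaultTolerantZFS G B × ∣ B ∣ ≡ k) ×
  (∀ (B : Subset n) → IsFaultTolerantZFS G B → k ≤ ∣ B ∣)

{-# OPTIONS --safe #-}

-- Let B be a fault tolerant zero forcing set of G - v, copied into G, and put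
-- A = B ∪ {v, y}.  If a vertex other than v is lost, v is still blue, and every
-- force of G - v is then a force of G, so all but one vertex of B suffice.  If v
-- is lost, B ∪ {y} must force v: run the forcing of G - v from B inside G.
-- Either it completes and a neighbour of v forces v, or it first gets stuck at
-- a blue b whose only white neighbours are v and some x; taking y = x lets b
-- force v.  Z_t(G - v) exists because, with no isolated vertices, the whole
-- vertex set is fault tolerant; the minimum is found since zero forcing is
-- decidable (compute the closure under the colour change rule).

module Submission where

open import Defs
open import Data.Nat using (ℕ; suc; _≤_; _+_)
open import Data.Fin using (Fin)
open import Data.Product using (∃; _×_)

import Data.Bool as Bool
open import Data.Nat using (z≤n; s≤s; _<_; _∸_; _≤?_)
open import Data.Fin using (zero; suc; punchIn; punchOut; _≟_)
open import Data.Fin.Properties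
  using (any?; all?; punchIn-punchOut; punchInᵢ≢i; punchIn-injective)
open import Data.Fin.Subset
  using (Subset; inside; outside; _∈_; _∉_; _⊆_; _⊂_; _∪_; _-_; ⁅_⁆; ⊤; ∣_∣; Nonempty)
open import Data.Fin.Subset.Properties
  using ( _∈?_; anySubset?; ∈⊤; x∈⁅x⁆; x∈⁅y⁆⇒x≡y; ∣⁅x⁆∣≡1; ∣p∣≤n; ∣p∣≤∣x∷p∣; ∣p∣≡n⇒p≡⊤
        ; p⊆p∪q; q⊆p∪q; x∈p∪q⁺; x∈p∪q⁻; p─⊥≡p; p─q⊆p; x∈p∧x≢y⇒x∈p-y; x∈p⇒∣p-x∣<∣p∣
        ; p⊂q⇒∣p∣<∣q∣ )
import Data.Nat as ℕ
open import Data.Nat.Properties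
  using ( ≤-trans; ≤-antisym; ≤-reflexive; ≤⇒≯; ≮⇒≥; <⇒≤pred; +-suc; +-monoʳ-≤
        ; m≤m+n; m+[n∸m]≡n; anyUpTo?; module ≤-Reasoning )
open import Data.Nat.Induction using (<-rec)
open import Data.Product using (∃₂; _,_; proj₁; proj₂; uncurry)
import Data.Product as Product
open import Data.Sum using (inj₁; inj₂)
open import Data.Vec using (_∷_; []; here; there; insertAt)
open import Data.Vec.Properties using (insertAt-lookup; insertAt-punchIn; []=⇒lookup; lookup⇒[]=)
open import Function using (_∘_)
open import Relation.Nullary using (¬_; Dec; yes; no; contradiction)
open import Relation.Nullary.Decidable using (map′; _×-dec_; _→-dec_; ¬?; decidable-stable)
open import Relation.Unary using (Pred; Decidable)
open import Relation.Binary.PropositionalEquality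
  using (_≡_; _≢_; refl; sym; trans; cong; cong₂; subst)

private variable
  n : ℕ

least-witness : ∀ {ℓ} {P : Pred ℕ ℓ} → Decidable P →
                ∀ {m} → P m → ∃ λ k → P k × (∀ {j} → P j → k ≤ j)
least-witness {P = P} P? {m} = <-rec Goal search m
  where
  Goal : ℕ → Set _
  Goal m = P m → ∃ λ k → P k × (∀ {j} → P j → k ≤ j)
  search : ∀ m → (∀ {j} → j < m → Goal j) → Goal m
  search m smaller Pm with anyUpTo? P? m
  ... | yes (j , j<m , Pj) = smaller j<m Pj
  ... | no  ∄j<m           = m , Pm , λ {j} Pj → ≮⇒≥ (λ j<m → ∄j<m (j , j<m , Pj))

x∉p-x : ∀ (p : Subset n) x → x ∉ p - x
x∉p-x (s ∷ p) zero    ()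
x∉p-x (s ∷ p) (suc x) (there x∈p-x) = x∉p-x p x x∈p-x

x∈p⇒1≤∣p∣ : ∀ {p : Subset n} {x} → x ∈ p → 1 ≤ ∣ p ∣
x∈p⇒1≤∣p∣ x∈p = ≤-trans (s≤s z≤n) (x∈p⇒∣p-x∣<∣p∣ x∈p)

∣p-x∣≡∣p∣∸1 : ∀ {p : Subset n} {x} → x ∈ p → ∣ p - x ∣ ≡ ∣ p ∣ ∸ 1
∣p-x∣≡∣p∣∸1 {p = inside  ∷ p} here        = cong ∣_∣ (p─⊥≡p p)
∣p-x∣≡∣p∣∸1 {p = inside  ∷ p} (there x∈p) =
  trans (cong suc (∣p-x∣≡∣p∣∸1 x∈p)) (m+[n∸m]≡n (x∈p⇒1≤∣p∣ x∈p))
∣p-x∣≡∣p∣∸1 {p = outside ∷ p} (there x∈p) = ∣p-x∣≡∣p∣∸1 x∈p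

1≤∣p∣⇒Nonempty : ∀ (p : Subset n) → 1 ≤ ∣ p ∣ → Nonempty p
1≤∣p∣⇒Nonempty (inside  ∷ p) _      = zero , here
1≤∣p∣⇒Nonempty (outside ∷ p) 1≤∣p∣ = Product.map suc there (1≤∣p∣⇒Nonempty p 1≤∣p∣)

p⊆q∧∣q∣≤∣p∣⇒q⊆p : ∀ {p q : Subset n} → p ⊆ q → ∣ q ∣ ≤ ∣ p ∣ → q ⊆ p
p⊆q∧∣q∣≤∣p∣⇒q⊆p {p = p} p⊆q ∣q∣≤∣p∣ {x} x∈q with x ∈? p
... | yes x∈p = x∈p
... | no  x∉p = contradiction (p⊂q⇒∣p∣<∣q∣ (p⊆q , x , x∈q , x∉p)) (≤⇒≯ ∣q∣≤∣p∣)

q⊆p∧∣q∣≡∣p∣∸1⇒p-x⊆q : ∀ {p q : Subset n} → q ⊆ p → 1 ≤ ∣ p ∣ → ∣ q ∣ ≡ ∣ p ∣ ∸ 1 →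
                       ∃ λ x → p - x ⊆ q
q⊆p∧∣q∣≡∣p∣∸1⇒p-x⊆q {p = p} {q} q⊆p 1≤∣p∣ ∣q∣≡∣p∣∸1
  with any? (λ x → x ∈? p ×-dec ¬? (x ∈? q))
... | yes (x , x∈p , x∉q) = x , p⊆q∧∣q∣≤∣p∣⇒q⊆p q⊆p-x ∣p-x∣≤∣q∣
  where
  q⊆p-x : q ⊆ p - x
  q⊆p-x y∈q = x∈p∧x≢y⇒x∈p-y (q⊆p y∈q) (λ { refl → x∉q y∈q })
  ∣p-x∣≤∣q∣ : ∣ p - x ∣ ≤ ∣ q ∣
  ∣p-x∣≤∣q∣ = subst (∣ p - x ∣ ≤_) (sym ∣q∣≡∣p∣∸1) (<⇒≤pred (x∈p⇒∣p-x∣<∣p∣ x∈p))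
... | no ∄x∈p∖q = proj₁ (1≤∣p∣⇒Nonempty p 1≤∣p∣) , λ {y} y∈p-x →
  decidable-stable (y ∈? q) (λ y∉q → ∄x∈p∖q (y , p─q⊆p p _ y∈p-x , y∉q))

∣p∪q∣≤∣p∣+∣q∣ : ∀ (p q : Subset n) → ∣ p ∪ q ∣ ≤ ∣ p ∣ + ∣ q ∣
∣p∪q∣≤∣p∣+∣q∣ []            []            = z≤n
∣p∪q∣≤∣p∣+∣q∣ (inside  ∷ p) (s ∷ q)       =
  s≤s (≤-trans (∣p∪q∣≤∣p∣+∣q∣ p q) (+-monoʳ-≤ ∣ p ∣ (∣p∣≤∣x∷p∣ s q)))
∣p∪q∣≤∣p∣+∣q∣ (outside ∷ p) (inside  ∷ q) =
  ≤-trans (s≤s (∣p∪q∣≤∣p∣+∣q∣ p q)) (≤-reflexive (sym (+-suc ∣ p ∣ ∣ q ∣)))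
∣p∪q∣≤∣p∣+∣q∣ (outside ∷ p) (outside ∷ q) = ∣p∪q∣≤∣p∣+∣q∣ p q

data PunchInView (i : Fin (suc n)) : Fin (suc n) → Set where
  at-pivot : PunchInView i i
  punched  : ∀ j → PunchInView i (punchIn i j)

punchInView : ∀ (i j : Fin (suc n)) → PunchInView i j
punchInView i j with i ≟ j
... | yes refl = at-pivot
... | no  i≢j  = subst (PunchInView i) (punchIn-punchOut i≢j) (punched (punchOut i≢j))

∈-insertAt⁺ : ∀ (p : Subset n) i s {x} → x ∈ p → punchIn i x ∈ insertAt p i s
∈-insertAt⁺ p i s {x} x∈p =
  lookup⇒[]= (punchIn i x) (insertAt p i s) (trans (insertAt-punchIn p i s x) ([]=⇒lookup x∈p))

insertAt-outside-⊆ : ∀ {p : Subset n} {i} {q} → (∀ {x} → x ∈ p → punchIn i x ∈ q) →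
                     insertAt p i outside ⊆ q
insertAt-outside-⊆ {p = p} {i} inc {y} y∈ with punchInView i y
... | at-pivot  = contradiction (trans (sym (insertAt-lookup p i outside)) ([]=⇒lookup y∈)) λ ()
... | punched x =
  inc (lookup⇒[]= x p (trans (sym (insertAt-punchIn p i outside x)) ([]=⇒lookup y∈)))

∣insertAt[p,i,outside]∣≡∣p∣ : ∀ (p : Subset n) i → ∣ insertAt p i outside ∣ ≡ ∣ p ∣
∣insertAt[p,i,outside]∣≡∣p∣ p             zero    = refl
∣insertAt[p,i,outside]∣≡∣p∣ (inside  ∷ p) (suc i) = cong suc (∣insertAt[p,i,outside]∣≡∣p∣ p i)
∣insertAt[p,i,outside]∣≡∣p∣ (outside ∷ p) (suc i) = ∣insertAt[p,i,outside]∣≡∣p∣ p i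

module _ (G : SimpleGraph n) where

  Adj⇒≢ : ∀ {i j} → Adj G i j → i ≢ j
  Adj⇒≢ {i} i~i refl = contradiction (trans (sym i~i) (irrefl G i)) λ ()

  Adj-sym : ∀ {i j} → Adj G i j → Adj G j i
  Adj-sym {i} {j} i~j = trans (adj-sym G j i) i~j

  adj? : ∀ i j → Dec (Adj G i j)
  adj? i j = adj G i j Bool.≟ Bool.true

  Blue-mono : ∀ {F F′ x} → F ⊆ F′ → Blue G F x → Blue G F′ x
  Blue-mono F⊆F′ (initial x∈F)           = initial (F⊆F′ x∈F)
  Blue-mono F⊆F′ (force b-blue b~w others) =
    force (Blue-mono F⊆F′ b-blue) b~w (λ u b~u u≢w → Blue-mono F⊆F′ (others u b~u u≢w))

  CanForce : Subset n → Fin n → Fin n → Set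
  CanForce S b w = b ∈ S × w ∉ S × Adj G b w × (∀ u → Adj G b u → u ≢ w → u ∈ S)

  canForce? : ∀ S → Dec (∃₂ (CanForce S))
  canForce? S = any? λ b → any? λ w →
    b ∈? S ×-dec ¬? (w ∈? S) ×-dec adj? b w ×-dec
    all? λ u → adj? b u →-dec ¬? (u ≟ w) →-dec u ∈? S

  Blue⊆stalled : ∀ {F C x} → F ⊆ C → ¬ ∃₂ (CanForce C) → Blue G F x → x ∈ C
  Blue⊆stalled F⊆C stalled (initial x∈F) = F⊆C x∈F
  Blue⊆stalled {C = C} F⊆C stalled (force {b} {w} b-blue b~w others) with w ∈? C
  ... | yes w∈C = w∈C
  ... | no  w∉C = contradiction
    (b , w , Blue⊆stalled F⊆C stalled b-blue , w∉C , b~w ,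
     λ u b~u u≢w → Blue⊆stalled F⊆C stalled (others u b~u u≢w))
    stalled

  closure : ℕ → Subset n → Subset n
  closure ℕ.zero  S = S
  closure (suc k) S with canForce? S
  ... | yes (_ , w , _) = closure k (S ∪ ⁅ w ⁆)
  ... | no  _           = S

  ⊆-closure : ∀ k S → S ⊆ closure k S
  ⊆-closure ℕ.zero  S x∈S = x∈S
  ⊆-closure (suc k) S x∈S with canForce? S
  ... | yes (_ , w , _) = ⊆-closure k (S ∪ ⁅ w ⁆) (p⊆p∪q ⁅ w ⁆ x∈S)
  ... | no  _           = x∈S

  closure-Blue : ∀ {F} k S → (∀ {x} → x ∈ S → Blue G F x) →
                 ∀ {x} → x ∈ closure k S → Blue G F x
  closure-Blue ℕ.zero  S blue = blue
  closure-Blue {F} (suc k) S blue with canForce? S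
  ... | no  _ = blue
  ... | yes (b , w , b∈S , _ , b~w , others) = closure-Blue k (S ∪ ⁅ w ⁆) blue′
    where
    blue′ : ∀ {x} → x ∈ S ∪ ⁅ w ⁆ → Blue G F x
    blue′ x∈ with x∈p∪q⁻ S ⁅ w ⁆ x∈
    ... | inj₁ x∈S   = blue x∈S
    ... | inj₂ x∈⁅w⁆ rewrite x∈⁅y⁆⇒x≡y w x∈⁅w⁆ =
      force (blue b∈S) b~w (λ u b~u u≢w → blue (others u b~u u≢w))

  -- Each productive step enlarges S, so n steps of fuel suffice.
  closure-stalled : ∀ k S → n ≤ k + ∣ S ∣ → ¬ ∃₂ (CanForce (closure k S))
  closure-stalled ℕ.zero S n≤∣S∣ (_ , w , _ , w∉S , _) =
    w∉S (subst (w ∈_) (sym (∣p∣≡n⇒p≡⊤ (≤-antisym (∣p∣≤n S) n≤∣S∣))) ∈⊤)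
  closure-stalled (suc k) S n≤1+k+∣S∣ with canForce? S
  ... | no  stalled = stalled
  ... | yes (_ , w , _ , w∉S , _) = closure-stalled k (S ∪ ⁅ w ⁆) (begin
      n                      ≤⟨ n≤1+k+∣S∣ ⟩
      suc (k + ∣ S ∣)        ≡⟨ +-suc k ∣ S ∣ ⟨
      k + suc ∣ S ∣          ≤⟨ +-monoʳ-≤ k (p⊂q⇒∣p∣<∣q∣ S⊂S∪⁅w⁆) ⟩
      k + ∣ S ∪ ⁅ w ⁆ ∣      ∎)
    where
    open ≤-Reasoning
    S⊂S∪⁅w⁆ : S ⊂ S ∪ ⁅ w ⁆
    S⊂S∪⁅w⁆ = p⊆p∪q ⁅ w ⁆ , w , q⊆p∪q S ⁅ w ⁆ (x∈⁅x⁆ w) , w∉S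

  Blue? : ∀ F x → Dec (Blue G F x)
  Blue? F x = map′ (closure-Blue n F initial)
                   (Blue⊆stalled (⊆-closure n F) (closure-stalled n F (m≤m+n n ∣ F ∣)))
                   (x ∈? closure n F)

  isZeroForcingSet? : ∀ F → Dec (IsZeroForcingSet G F)
  isZeroForcingSet? F = all? (Blue? F)

  isFaultTolerant⇒zfs-minus : ∀ {B} → IsFaultTolerantZFS G B → ∀ x → IsZeroForcingSet G (B - x)
  isFaultTolerant⇒zfs-minus {B} (1≤∣B∣ , zfs) x with x ∈? B
  ... | yes x∈B = zfs (B - x) (p─q⊆p B ⁅ x ⁆) (∣p-x∣≡∣p∣∸1 x∈B)
  ... | no  x∉B with 1≤∣p∣⇒Nonempty B 1≤∣B∣
  ...   | y , y∈B = Blue-mono B-y⊆B-x ∘ zfs (B - y) (p─q⊆p B ⁅ y ⁆) (∣p-x∣≡∣p∣∸1 y∈B)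
    where
    B-y⊆B-x : B - y ⊆ B - x
    B-y⊆B-x z∈B-y = x∈p∧x≢y⇒x∈p-y z∈B (λ { refl → x∉B z∈B })
      where z∈B = p─q⊆p B ⁅ y ⁆ z∈B-y

  isFaultTolerant⇒zfs : ∀ {B} → IsFaultTolerantZFS G B → IsZeroForcingSet G B
  isFaultTolerant⇒zfs {B} ft@(1≤∣B∣ , _) =
    let x = proj₁ (1≤∣p∣⇒Nonempty B 1≤∣B∣)
    in Blue-mono (p─q⊆p B ⁅ x ⁆) ∘ isFaultTolerant⇒zfs-minus ft x

  zfs-minus⇒isFaultTolerant : ∀ {B} → 1 ≤ ∣ B ∣ → (∀ x → IsZeroForcingSet G (B - x)) →
                              IsFaultTolerantZFS G B
  zfs-minus⇒isFaultTolerant 1≤∣B∣ zfs = 1≤∣B∣ , λ F F⊆B ∣F∣≡∣B∣∸1 →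
    let (x , B-x⊆F) = q⊆p∧∣q∣≡∣p∣∸1⇒p-x⊆q F⊆B 1≤∣B∣ ∣F∣≡∣B∣∸1
    in Blue-mono B-x⊆F ∘ zfs x

  isFaultTolerantZFS? : ∀ B → Dec (IsFaultTolerantZFS G B)
  isFaultTolerantZFS? B =
    map′ (uncurry zfs-minus⇒isFaultTolerant) (λ ft → proj₁ ft , isFaultTolerant⇒zfs-minus ft)
         (1 ≤? ∣ B ∣ ×-dec all? (isZeroForcingSet? ∘ (B -_)))

  Zt-exists : ZtExists G → ∃ (IsZt G)
  Zt-exists (B , ft) =
    let (k , witness , minimal) = least-witness size? (B , ft , refl)
    in k , witness , λ B ft → minimal (B , ft , refl)
    where
    size? : ∀ k → Dec (∃ λ B → IsFaultTolerantZFS G B × ∣ B ∣ ≡ k)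
    size? k = anySubset? λ B → isFaultTolerantZFS? B ×-dec ∣ B ∣ ℕ.≟ k

  ZtExists⇒NoIsolated : ZtExists G → NoIsolated G
  ZtExists⇒NoIsolated (B , ft) v with isFaultTolerant⇒zfs-minus ft v v
  ... | initial v∈B-v      = contradiction v∈B-v (x∉p-x B v)
  ... | force {b} _ b~v _ = b , Adj-sym b~v

  NoIsolated⇒⊤-isFaultTolerant : NoIsolated G → Fin n → IsFaultTolerantZFS G ⊤
  NoIsolated⇒⊤-isFaultTolerant no-isolated x =
    zfs-minus⇒isFaultTolerant (x∈p⇒1≤∣p∣ (∈⊤ {x = x})) ⊤-minus-zfs
    where
    ∈⊤-x : ∀ {y x} → y ≢ x → y ∈ ⊤ - x
    ∈⊤-x = x∈p∧x≢y⇒x∈p-y ∈⊤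
    ⊤-minus-zfs : ∀ x → IsZeroForcingSet G (⊤ - x)
    ⊤-minus-zfs x z with z ≟ x
    ... | no  z≢x  = initial (∈⊤-x z≢x)
    ... | yes refl with no-isolated z
    ...   | j , z~j = force (initial (∈⊤-x (Adj⇒≢ (Adj-sym z~j)))) (Adj-sym z~j)
                            (λ u _ u≢z → initial (∈⊤-x u≢z))

module Deletion {n} (G : SimpleGraph (suc n)) (v : Fin (suc n)) where

  H : SimpleGraph n
  H = deleteVertex G v

  Blocked : Subset (suc n) → Fin (suc n) → Fin (suc n) → Set
  Blocked D b x = Blue G D b × Adj G b v × Adj G b x × x ≢ v ×
                  (∀ u → Adj G b u → u ≢ x → u ≢ v → Blue G D u)

  blocked? : ∀ D → Dec (∃₂ (Blocked D))
  blocked? D = any? λ b → any? λ x →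
    Blue? G D b ×-dec adj? G b v ×-dec adj? G b x ×-dec ¬? (x ≟ v) ×-dec
    all? λ u → adj? G b u →-dec ¬? (u ≟ x) →-dec ¬? (u ≟ v) →-dec Blue? G D u

  -- A force b → w of H stays valid in G unless v is a white neighbour of b,
  -- and then b is blocked.
  Blue-lift : ∀ {F D} → (∀ {k} → k ∈ F → punchIn v k ∈ D) →
              (∀ {b x} → Blocked D b x → Blue G D v) →
              ∀ {z} → Blue H F z → Blue G D (punchIn v z)
  Blue-lift inc escape (initial z∈F) = initial (inc z∈F)
  Blue-lift {D = D} inc escape (force {b} {w} b-blue b~w others) =
    force (Blue-lift inc escape b-blue) b~w others′
    where
    lifted : ∀ k → Adj G (punchIn v b) (punchIn v k) → punchIn v k ≢ punchIn v w →
             Blue G D (punchIn v k)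
    lifted k b~k k≢w = Blue-lift inc escape (others k b~k (k≢w ∘ cong (punchIn v)))
    others-but-v : ∀ u → Adj G (punchIn v b) u → u ≢ punchIn v w → u ≢ v → Blue G D u
    others-but-v u b~u u≢w u≢v with punchInView v u
    ... | at-pivot  = contradiction refl u≢v
    ... | punched k = lifted k b~u u≢w
    others′ : ∀ u → Adj G (punchIn v b) u → u ≢ punchIn v w → Blue G D u
    others′ u b~u u≢w with punchInView v u
    ... | at-pivot  =
      escape (Blue-lift inc escape b-blue , b~u , b~w , punchInᵢ≢i v w , others-but-v)
    ... | punched k = lifted k b~u u≢w

  zfs-lift : ∀ {F D} → Blue G D v → (∀ {k} → k ∈ F → punchIn v k ∈ D) →
             IsZeroForcingSet H F → IsZeroForcingSet G D
  zfs-lift v-blue inc zfs x with punchInView v x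
  ... | at-pivot  = v-blue
  ... | punched k = Blue-lift inc (λ _ → v-blue) (zfs k)

  blocked⇒Blue-v : ∀ {D F b x} → D ⊆ F → x ∈ F → Blocked D b x → Blue G F v
  blocked⇒Blue-v {x = x} D⊆F x∈F (b-blue , b~v , _ , _ , others) =
    force (Blue-mono G D⊆F b-blue) b~v others′
    where
    others′ : ∀ u → Adj G _ u → u ≢ v → Blue G _ u
    others′ u b~u u≢v with u ≟ x
    ... | yes refl = initial x∈F
    ... | no  u≢x  = Blue-mono G D⊆F (others u b~u u≢x u≢v)

  zfs-partner : ∀ {B} → IsZeroForcingSet H B → ∃ (Adj G v) →
                ∃ λ y → y ≢ v × (∀ {F} → (∀ {k} → k ∈ B → punchIn v k ∈ F) → y ∈ F →
                                 IsZeroForcingSet G F)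
  zfs-partner {B} zfs (u , v~u) with blocked? (insertAt B v outside)
  ... | yes (_ , x , blocked@(_ , _ , _ , x≢v , _)) = x , x≢v , λ inc x∈F →
    zfs-lift (blocked⇒Blue-v (insertAt-outside-⊆ inc) x∈F blocked) inc zfs
  ... | no  unblocked = u , Adj⇒≢ G (Adj-sym G v~u) , λ inc _ →
    zfs-lift (Blue-mono G (insertAt-outside-⊆ inc) v-blue) inc zfs
    where
    D : Subset (suc n)
    D = insertAt B v outside
    Blue-off-v : ∀ {x} → x ≢ v → Blue G D x
    Blue-off-v {x} x≢v with punchInView v x
    ... | at-pivot  = contradiction refl x≢v
    ... | punched k =
      Blue-lift (∈-insertAt⁺ B v outside)
                (λ blocked → contradiction (_ , _ , blocked) unblocked) (zfs k)
    v-blue : Blue G D v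
    v-blue = force (Blue-off-v (Adj⇒≢ G (Adj-sym G v~u))) (Adj-sym G v~u)
                   (λ w _ w≢v → Blue-off-v w≢v)

  isFaultTolerant-lift : ∀ {B} → ∃ (Adj G v) → IsFaultTolerantZFS H B →
                         ∃ λ A → IsFaultTolerantZFS G A × ∣ A ∣ ≤ ∣ B ∣ + 2
  isFaultTolerant-lift {B} v~u ft with zfs-partner (isFaultTolerant⇒zfs H ft) v~u
  ... | y , y≢v , zfs-with-y =
    A , zfs-minus⇒isFaultTolerant G (x∈p⇒1≤∣p∣ v∈A) A-minus-zfs , ∣A∣≤∣B∣+2
    where
    D A : Subset (suc n)
    D = insertAt B v outside
    A = D ∪ ⁅ v ⁆ ∪ ⁅ y ⁆
    v∈A : v ∈ A
    v∈A = x∈p∪q⁺ (inj₂ (x∈p∪q⁺ (inj₁ (x∈⁅x⁆ v))))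
    y∈A : y ∈ A
    y∈A = x∈p∪q⁺ (inj₂ (x∈p∪q⁺ (inj₂ (x∈⁅x⁆ y))))
    B↪A : ∀ {k} → k ∈ B → punchIn v k ∈ A
    B↪A k∈B = x∈p∪q⁺ (inj₁ (∈-insertAt⁺ B v outside k∈B))
    A-minus-zfs : ∀ x → IsZeroForcingSet G (A - x)
    A-minus-zfs x with punchInView v x
    ... | at-pivot  = zfs-with-y (λ k∈B → x∈p∧x≢y⇒x∈p-y (B↪A k∈B) (punchInᵢ≢i v _))
                                 (x∈p∧x≢y⇒x∈p-y y∈A y≢v)
    ... | punched i = zfs-lift (initial (x∈p∧x≢y⇒x∈p-y v∈A (punchInᵢ≢i v i ∘ sym))) B-i↪A-x
                               (isFaultTolerant⇒zfs-minus H ft i)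
      where
      B-i↪A-x : ∀ {k} → k ∈ B - i → punchIn v k ∈ A - punchIn v i
      B-i↪A-x {k} k∈B-i = x∈p∧x≢y⇒x∈p-y (B↪A (p─q⊆p B ⁅ i ⁆ k∈B-i))
        (λ k≡i → x∉p-x B i (subst (_∈ B - i) (punchIn-injective v k i k≡i) k∈B-i))
    ∣A∣≤∣B∣+2 : ∣ A ∣ ≤ ∣ B ∣ + 2
    ∣A∣≤∣B∣+2 = begin
      ∣ D ∪ ⁅ v ⁆ ∪ ⁅ y ⁆ ∣              ≤⟨ ∣p∪q∣≤∣p∣+∣q∣ D _ ⟩
      ∣ D ∣ + ∣ ⁅ v ⁆ ∪ ⁅ y ⁆ ∣          ≤⟨ +-monoʳ-≤ ∣ D ∣ (∣p∪q∣≤∣p∣+∣q∣ ⁅ v ⁆ ⁅ y ⁆) ⟩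
      ∣ D ∣ + (∣ ⁅ v ⁆ ∣ + ∣ ⁅ y ⁆ ∣)    ≡⟨ cong₂ _+_ (∣insertAt[p,i,outside]∣≡∣p∣ B v)
                                                     (cong₂ _+_ (∣⁅x⁆∣≡1 v) (∣⁅x⁆∣≡1 y)) ⟩
      ∣ B ∣ + 2                          ∎
      where open ≤-Reasoning

theorem4p7 : ∀ {n : ℕ} (G : SimpleGraph (suc n)) (v : Fin (suc n)) →
    ZtExists G → NoIsolated (deleteVertex G v) →
    (∃ λ (b : ℕ) → IsZt (deleteVertex G v) b) ×
    (∀ (a b : ℕ) → IsZt G a → IsZt (deleteVertex G v) b → a ≤ b + 2)
theorem4p7 {n} G v Zt[G]-exists H-no-isolated =
  Zt-exists H (⊤ , NoIsolated⇒⊤-isFaultTolerant H H-no-isolated some-vertex) , bound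
  where
  open Deletion G v
  v-neighbour : ∃ (Adj G v)
  v-neighbour = ZtExists⇒NoIsolated G Zt[G]-exists v
  some-vertex : Fin n
  some-vertex = punchOut (Adj⇒≢ G (proj₂ v-neighbour))
  bound : ∀ a b → IsZt G a → IsZt H b → a ≤ b + 2
  bound a b (_ , a-minimal) ((B , ft , refl) , _) =
    let (A , ftA , ∣A∣≤∣B∣+2) = isFaultTolerant-lift v-neighbour ft
    in ≤-trans (a-minimal A ftA) ∣A∣≤∣B∣+2
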